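{- Let $f,g,h$ be monotone functions on binary relations over a set $X$, and let $m\ge 1$ be an integer. Suppose $f$ is $g$-compatible and $g^m,h$-compatible. Let $f'=\bigcup_{0\le i\le m}f^i$. Then $f$ is $(g\cap h)$-sound via $f'^\omega$; that is, $f'^\omega$ is extensive and for every relation $\mathcal R$ on $X$, $\mathcal R\subseteq (g\cap h)(f(\mathcal R))$ implies $f'^\omega(\mathcal R)\subseteq (g\cap h)(f'^\omega(\mathcal R))$.
   Context: Fix a set $X$. A function on relations is a map from the set of binary relations on $X$ to itself. For such functions, $(f\circ g)(\mathcal R)=f(g(\mathcal R))$, $(f\cap g)(\mathcal R)=f(\mathcal R)\cap g(\mathcal R)$, $(f\cup g)(\mathcal R)=f(\mathcal R)\cup g(\mathcal R)$ (and similarly for indexed unions), and $f\subseteq g$ means $f(\mathcal R)\subseteq g(\mathcal R)$ for all $\mathcal R$. $f^0=\mathrm{id}$, $f^{n+1}=f\circ f^n$, $f^\omega(\mathcal R)=\bigcup_{n\in\mathbb N}f^n(\mathcal R)$. $f$ is monotone if $\mathcal R\subseteq\mathcal S$ implies $f(\mathcal R)\subseteq f(\mathcal S)$; $f$ is extensive if $\mathrm{id}\subseteq f$. $f$ is $g$-compatible if $f\circ g\subseteq g\circ f$. $f$ is $g,h$-compatible if $f\circ(g\cap h)\subseteq h\circ f$. $f$ is $g$-sound via $f'$ if $f'$ is extensive and for every relation $\mathcal R$, $\mathcal R\subseteq g(f(\mathcal R))$ implies $f'(\mathcal R)\subseteq g(f'(\mathcal R))$. -}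

module Defs where

open import Level using (Level; _⊔_)
open import Data.Nat using (ℕ; zero; suc; _≤_)
open import Data.Product using (Σ; _×_; _,_)
open import Data.Sum using (_⊎_)
open import Relation.Binary.Core using (Rel)
open import Relation.Binary.Definitions using ()

FunRel : ∀ {a} (X : Set a) (ℓ : Level) → Set (a ⊔ Level.suc ℓ)
FunRel X ℓ = Rel X ℓ → Rel X ℓ

module _ {a ℓ : Level} {X : Set a} where

  _⊆ᴿ_ : Rel X ℓ → Rel X ℓ → Set (a ⊔ ℓ)
  R ⊆ᴿ S = ∀ {x y} → R x y → S x y

  _∩ᴿ_ : Rel X ℓ → Rel X ℓ → Rel X ℓ
  (R ∩ᴿ S) x y = R x y × S x y

  _∘ᶠ_ : FunRel X ℓ → FunRel X ℓ → FunRel X ℓ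
  (f ∘ᶠ g) R = f (g R)

  _∩ᶠ_ : FunRel X ℓ → FunRel X ℓ → FunRel X ℓ
  (f ∩ᶠ g) R = f R ∩ᴿ g R

  _⊆ᶠ_ : FunRel X ℓ → FunRel X ℓ → Set (a ⊔ Level.suc ℓ)
  f ⊆ᶠ g = ∀ R → f R ⊆ᴿ g R

  idᶠ : FunRel X ℓ
  idᶠ R = R

  _^ᶠ_ : FunRel X ℓ → ℕ → FunRel X ℓ
  f ^ᶠ zero = idᶠ
  f ^ᶠ suc n = f ∘ᶠ (f ^ᶠ n)

  _^ω : FunRel X ℓ → FunRel X ℓ
  (f ^ω) R x y = Σ ℕ (λ n → (f ^ᶠ n) R x y)

  upTo : FunRel X ℓ → ℕ → FunRel X ℓ
  upTo f m R x y = Σ ℕ (λ i → i ≤ m × (f ^ᶠ i) R x y)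

  Monotone : FunRel X ℓ → Set (a ⊔ Level.suc ℓ)
  Monotone f = ∀ {R S} → R ⊆ᴿ S → f R ⊆ᴿ f S

  Extensive : FunRel X ℓ → Set (a ⊔ Level.suc ℓ)
  Extensive f = idᶠ ⊆ᶠ f

  Compatible : FunRel X ℓ → FunRel X ℓ → Set (a ⊔ Level.suc ℓ)
  Compatible f g = (f ∘ᶠ g) ⊆ᶠ (g ∘ᶠ f)

  Compatible₂ : FunRel X ℓ → FunRel X ℓ → FunRel X ℓ → Set (a ⊔ Level.suc ℓ)
  Compatible₂ f g h = (f ∘ᶠ (g ∩ᶠ h)) ⊆ᶠ (h ∘ᶠ f)

  SoundVia : FunRel X ℓ → FunRel X ℓ → FunRel X ℓ → Set (a ⊔ Level.suc ℓ)
  SoundVia f g f' = Extensive f' × (∀ R → R ⊆ᴿ g (f R) → f' R ⊆ᴿ g (f' R))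

-- Put F = ⋃_{i ≤ m} fⁱ. Compatibility passes to powers, to finite unions of powers and to
-- F^ω = ⋃ₙ Fⁿ, and F^ω absorbs any Fʲ; hence R ⊆ q (Fʲ R) with q F-compatible already gives
-- F^ω R ⊆ q (F^ω R). For q = g take j = 1. For q = gᵐ ∩ h take j = m: iterating R ⊆ g (F R)
-- gives R ⊆ gᵐ (Fᵐ R), and R ⊆ h (f R) ⊆ h (Fᵐ R) since m ≥ 1; moreover f is (gᵐ ∩ h)-compatible
-- because it is gᵐ-compatible and gᵐ,h-compatible.
module Submission where

open import Defs
open import Level using (Level)
open import Data.Nat using (ℕ; zero; suc; _+_; _≤_; z≤n; s≤s)
open import Data.Product using (_,_; proj₁; proj₂)
open import Relation.Binary.Core using (Rel)
open import Relation.Binary.PropositionalEquality using (_≡_; refl; cong; subst)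

module _ {a ℓ : Level} {X : Set a} where

  private variable
    p q r : FunRel X ℓ

  ^ᶠ-monotone : Monotone p → ∀ n → Monotone (p ^ᶠ n)
  ^ᶠ-monotone mp zero    R⊆S = R⊆S
  ^ᶠ-monotone mp (suc n) R⊆S = mp (^ᶠ-monotone mp n R⊆S)

  ^ᶠ-extensive : Extensive p → ∀ n → Extensive (p ^ᶠ n)
  ^ᶠ-extensive ep zero    R z = z
  ^ᶠ-extensive ep (suc n) R z = ep _ (^ᶠ-extensive ep n R z)

  ^ᶠ-+ : ∀ n j (R : Rel X ℓ) → (p ^ᶠ n) ((p ^ᶠ j) R) ≡ (p ^ᶠ (n + j)) R
  ^ᶠ-+ zero    j R = refl
  ^ᶠ-+ {p = p} (suc n) j R = cong p (^ᶠ-+ n j R)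

  ∩ᶠ-monotone : Monotone q → Monotone r → Monotone (q ∩ᶠ r)
  ∩ᶠ-monotone mq mr R⊆S (x , y) = mq R⊆S x , mr R⊆S y

  compatible-^ᶠʳ : Monotone q → Compatible p q → ∀ j → Compatible p (q ^ᶠ j)
  compatible-^ᶠʳ mq c zero    S z = z
  compatible-^ᶠʳ mq c (suc j) S z = mq (compatible-^ᶠʳ mq c j S) (c _ z)

  compatible-^ᶠˡ : Monotone p → Compatible p q → ∀ n → Compatible (p ^ᶠ n) q
  compatible-^ᶠˡ mp c zero    S z = z
  compatible-^ᶠˡ mp c (suc n) S z = c _ (mp (compatible-^ᶠˡ mp c n S) z)

  compatible-∩ᶠ : Monotone p → Compatible p q → Compatible₂ p q r → Compatible p (q ∩ᶠ r)
  compatible-∩ᶠ mp c c₂ S z = c S (mp proj₁ z) , c₂ S z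

  upTo-monotone : Monotone p → ∀ m → Monotone (upTo p m)
  upTo-monotone mp m R⊆S (i , i≤m , z) = i , i≤m , ^ᶠ-monotone mp i R⊆S z

  upTo-extensive : ∀ m → Extensive (upTo p m)
  upTo-extensive m R z = 0 , z≤n , z

  upTo-compatible : Monotone p → Monotone q → Compatible p q → ∀ m → Compatible (upTo p m) q
  upTo-compatible mp mq c m S (i , i≤m , z) =
    mq (λ w → i , i≤m , w) (compatible-^ᶠˡ mp c i S z)

  ^ω-extensive : Extensive (p ^ω)
  ^ω-extensive R z = 0 , z

  ^ω-monotone : Monotone p → Monotone (p ^ω)
  ^ω-monotone mp R⊆S (n , z) = n , ^ᶠ-monotone mp n R⊆S z

  ^ω-compatible : Monotone p → Monotone q → Compatible p q → Compatible (p ^ω) q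
  ^ω-compatible mp mq c S (n , z) = mq (λ w → n , w) (compatible-^ᶠˡ mp c n S z)

  ^ω-absorbs-^ᶠ : ∀ j (R : Rel X ℓ) → (p ^ω) ((p ^ᶠ j) R) ⊆ᴿ (p ^ω) R
  ^ω-absorbs-^ᶠ j R (n , z) = n + j , subst (λ T → T _ _) (^ᶠ-+ n j R) z

  postfixed-^ᶠ : Monotone p → Monotone q → Compatible p q →
                 ∀ {R} → R ⊆ᴿ q (p R) → ∀ j → R ⊆ᴿ (q ^ᶠ j) ((p ^ᶠ j) R)
  postfixed-^ᶠ mp mq c R⊆qpR zero    z = z
  postfixed-^ᶠ mp mq c R⊆qpR (suc j) z =
    mq (compatible-^ᶠʳ mq c j _) (mq (mp (postfixed-^ᶠ mp mq c R⊆qpR j)) (R⊆qpR z))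

  ^ω-postfixed : Monotone p → Monotone q → Compatible p q →
                 ∀ j {R} → R ⊆ᴿ q ((p ^ᶠ j) R) → (p ^ω) R ⊆ᴿ q ((p ^ω) R)
  ^ω-postfixed mp mq c j {R} R⊆q z =
    mq (^ω-absorbs-^ᶠ j R) (^ω-compatible mp mq c _ (^ω-monotone mp R⊆q z))

theorem15 : ∀ {a ℓ : Level} {X : Set a} (f g h : FunRel X ℓ) (m : ℕ)
    → Monotone f → Monotone g → Monotone h
    → 1 ≤ m
    → Compatible f g
    → Compatible₂ f (g ^ᶠ m) h
    → SoundVia f (g ∩ᶠ h) ((upTo f m) ^ω)
theorem15 {ℓ = ℓ} {X = X} f g h m@(suc k) mf mg mh (s≤s _) cfg cfgᵐh = ^ω-extensive , sound
  where
  F : FunRel X ℓ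
  F = upTo f m
  mF : Monotone F
  mF = upTo-monotone mf m
  mgᵐ : Monotone (g ^ᶠ m)
  mgᵐ = ^ᶠ-monotone mg m
  cFg : Compatible F g
  cFg = upTo-compatible mf mg cfg m
  cFgᵐh : Compatible F ((g ^ᶠ m) ∩ᶠ h)
  cFgᵐh = upTo-compatible mf (∩ᶠ-monotone mgᵐ mh)
            (compatible-∩ᶠ mf (compatible-^ᶠʳ mg cfg m) cfgᵐh) m

  sound : ∀ R → R ⊆ᴿ (g ∩ᶠ h) (f R) → (F ^ω) R ⊆ᴿ (g ∩ᶠ h) ((F ^ω) R)
  sound R R⊆gfR∩hfR z =
    ^ω-postfixed mF mg cFg 1 R⊆gFR z ,
    proj₂ (^ω-postfixed mF (∩ᶠ-monotone mgᵐ mh) cFgᵐh m (λ w → R⊆gᵐFᵐR w , R⊆hFᵐR w) z)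
    where
    fR⊆FR : f R ⊆ᴿ F R
    fR⊆FR w = 1 , s≤s z≤n , w
    fR⊆FᵐR : f R ⊆ᴿ (F ^ᶠ m) R
    fR⊆FᵐR w = mF (^ᶠ-extensive (upTo-extensive m) k R) (fR⊆FR w)
    R⊆gFR : R ⊆ᴿ g (F R)
    R⊆gFR w = mg fR⊆FR (proj₁ (R⊆gfR∩hfR w))
    R⊆gᵐFᵐR : R ⊆ᴿ (g ^ᶠ m) ((F ^ᶠ m) R)
    R⊆gᵐFᵐR = postfixed-^ᶠ mF mg cFg R⊆gFR m
    R⊆hFᵐR : R ⊆ᴿ h ((F ^ᶠ m) R)
    R⊆hFᵐR w = mh fR⊆FᵐR (proj₂ (R⊆gfR∩hfR w))
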